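{- Given a sample $\mathcal S$, the decision-tree-based learning algorithm learns a (not necessarily minimal) LTL formula $\psi_t$ that is consistent with $\mathcal S$.
   Context: Let $\mathcal P$ be a finite nonempty set of atomic propositions. LTL formulas are built from atomic propositions $p \in \mathcal P$ using $\lnot$, $\lor$, the temporal operators $\mathbf{X}$ ("next") and $\mathbf{U}$ ("until"), with derived operators $\land$, $\rightarrow$, $\mathbf{F}\psi \coloneqq \mathit{true}\,\mathbf{U}\,\psi$ ("finally") and $\mathbf{G}\psi \coloneqq \lnot\mathbf{F}\lnot\psi$ ("globally"); they are interpreted over infinite words in $(2^{\mathcal P})^\omega$ with the standard semantics, and $V(\varphi,\alpha)\in\{0,1\}$ denotes the truth value of $\varphi$ on word $\alpha$. A sample $\mathcal S=(P,N)$ consists of two finite disjoint sets $P,N$ of ultimately periodic words $uv^\omega$, the positive and negative examples; an LTL formula $\varphi$ is consistent with $\mathcal S$ if $V(\varphi,\alpha)=1$ for all $\alpha\in P$ and $V(\varphi,\beta)=0$ for all $\beta\in N$. The decision-tree-based algorithm proceeds in two phases: (1) it repeatedly runs a SAT-based learner (which returns a minimal-size LTL formula consistent with a given sample) on small subsets of $P$ and $N$, collecting the resulting formulas into a set $\Pi=\{\varphi_1,\dots,\varphi_m\}$ of "LTL primitives" until for every pair $\alpha\in P$, $\beta\in N$ there is some $\varphi_i\in\Pi$ with $V(\varphi_i,\alpha)=1$ and $V(\varphi_i,\beta)=0$; (2) it maps each example to the Boolean feature vector $(V(\varphi_1,\cdot),\dots,V(\varphi_m,\cdot))$ labeled true for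 $P$ and false for $N$, learns a decision tree $t$ classifying all these vectors correctly (standard decision-tree learning, no pruning), and returns $\psi_t \coloneqq \bigvee_{\rho}\bigwedge_{\varphi\in\rho}\varphi$, where $\rho$ ranges over root-to-leaf paths ending in a leaf labeled true and each primitive on $\rho$ appears negated when the path takes its "false" branch. -}

module Defs where

open import Data.Nat using (ℕ; zero; suc; _<_; _≤_; _∸_; _%_)
open import Data.Nat.Properties using (_<?_)
open import Data.Bool using (Bool; true; false)
open import Data.Fin using (Fin)
open import Data.Fin.Subset using (Subset; _∈_)
open import Data.List using (List; []; _∷_; _++_; map; length; foldr)
open import Data.List.NonEmpty using (List⁺; _∷_; toList)
import Data.List.NonEmpty as L⁺
open import Data.List.Membership.Propositional renaming (_∈_ to _∈ˡ_)
open import Data.Vec using (Vec; lookup)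
open import Data.Product using (Σ; _×_; _,_; ∃)
open import Data.Sum using (_⊎_)
open import Data.Empty using (⊥)
open import Relation.Nullary using (¬_; yes; no)
open import Relation.Binary.PropositionalEquality using (_≡_)

-- Atomic propositions: Fin k (nonempty sets are represented by Fin (suc k)).
-- A letter of the alphabet 2^𝒫 is a subset of the propositions.

Letter : ℕ → Set
Letter k = Subset k

Word : ℕ → Set
Word k = ℕ → Letter k

data LTL (k : ℕ) : Set where
  atom  : Fin k → LTL k
  ¬'_   : LTL k → LTL k
  _∨'_  : LTL k → LTL k → LTL k
  X'_   : LTL k → LTL k
  _U'_  : LTL k → LTL k → LTL k

_∧'_ : ∀ {k} → LTL k → LTL k → LTL k
φ ∧' ψ = ¬' ((¬' φ) ∨' (¬' ψ))

-- true / false: available since 𝒫 is nonempty (we use proposition 0).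
trueF : ∀ {k} → LTL (suc k)
trueF = atom Fin.zero ∨' (¬' atom Fin.zero)
  where import Data.Fin as Fin

falseF : ∀ {k} → LTL (suc k)
falseF = ¬' trueF

Sat : ∀ {k} → Word k → ℕ → LTL k → Set
Sat w i (atom p) = p ∈ w i
Sat w i (¬' φ)   = ¬ (Sat w i φ)
Sat w i (φ ∨' ψ) = (Sat w i φ) ⊎ (Sat w i ψ)
Sat w i (X' φ)   = Sat w (suc i) φ
Sat w i (φ U' ψ) = Σ ℕ λ j → (i ≤ j) × (Sat w j ψ) × (∀ l → i ≤ l → l < j → Sat w l φ)

-- V(φ, α) = 1  ⇔  α ⊨ φ  (truth at position 0).
_⊨_ : ∀ {k} → Word k → LTL k → Set
w ⊨ φ = Sat w 0 φ

record Lasso (k : ℕ) : Set where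
  constructor _·_^ω
  field
    u : List (Letter k)
    v : List⁺ (Letter k)

private
  index : ∀ {A : Set} → A → List A → ℕ → A
  index d []       _       = d
  index d (x ∷ xs) zero    = x
  index d (x ∷ xs) (suc n) = index d xs n

word : ∀ {k} → Lasso k → Word k
word {k} (u · v ^ω) i with i <? length u
... | yes _ = index (L⁺.head v) u i
... | no  _ = index (L⁺.head v) (toList v) ((i ∸ length u) % L⁺.length v)

SameWord : ∀ {k} → Lasso k → Lasso k → Set
SameWord α β = ∀ i → word α i ≡ word β i

record Sample (k : ℕ) : Set where
  field
    Pos      : List (Lasso k)
    Neg      : List (Lasso k)
    disjoint : ∀ {α β} → α ∈ˡ Pos → β ∈ˡ Neg → ¬ SameWord α β
open Sample public

Consistent : ∀ {k} → LTL k → Sample k → Set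
Consistent φ S =
  (∀ {α} → α ∈ˡ Pos S → word α ⊨ φ) ×
  (∀ {β} → β ∈ˡ Neg S → ¬ (word β ⊨ φ))

-- Phase 1 outcome: the primitives Π = φ₁ … φₘ separate every pair.

Separates : ∀ {k m} → Vec (LTL k) m → Sample k → Set
Separates {m = m} Π S =
  ∀ {α β} → α ∈ˡ Pos S → β ∈ˡ Neg S →
    Σ (Fin m) λ i → (word α ⊨ lookup Π i) × ¬ (word β ⊨ lookup Π i)

-- Decision trees over the Boolean features V(φᵢ, ·).
-- node i t f : test feature i; go to t if it is 1, to f if it is 0.

data DTree (m : ℕ) : Set where
  leaf : Bool → DTree m
  node : Fin m → DTree m → DTree m → DTree m

data Classify {k m} (Π : Vec (LTL k) m) (w : Word k) : DTree m → Bool → Set where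
  leafC : ∀ {b} → Classify Π w (leaf b) b
  yesC  : ∀ {i t f b} → w ⊨ lookup Π i → Classify Π w t b → Classify Π w (node i t f) b
  noC   : ∀ {i t f b} → ¬ (w ⊨ lookup Π i) → Classify Π w f b → Classify Π w (node i t f) b

CorrectTree : ∀ {k m} → Vec (LTL k) m → Sample k → DTree m → Set
CorrectTree Π S t =
  (∀ {α} → α ∈ˡ Pos S → Classify Π (word α) t true) ×
  (∀ {β} → β ∈ˡ Neg S → Classify Π (word β) t false)

-- A path is a list of literals (feature index, branch taken).
truePaths : ∀ {m} → DTree m → List (List (Fin m × Bool))
truePaths (leaf true)  = [] ∷ []
truePaths (leaf false) = []
truePaths (node i t f) =
  map ((i , true) ∷_) (truePaths t) ++ map ((i , false) ∷_) (truePaths f)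

literal : ∀ {k m} → Vec (LTL k) m → Fin m × Bool → LTL k
literal Π (i , true)  = lookup Π i
literal Π (i , false) = ¬' lookup Π i

⋀ : ∀ {k} → List (LTL (suc k)) → LTL (suc k)
⋀ = foldr _∧'_ trueF

⋁ : ∀ {k} → List (LTL (suc k)) → LTL (suc k)
⋁ = foldr _∨'_ falseF

ψ : ∀ {k m} → Vec (LTL (suc k)) m → DTree m → LTL (suc k)
ψ Π t = ⋁ (map (λ ρ → ⋀ (map (literal Π) ρ)) (truePaths t))

module Submission where

-- (1) A correct decision tree exists.  Its leaves must be reached by every
--     example, so each feature V(φᵢ, α) must be computable: we first show that
--     LTL satisfaction is decidable on every word that is periodic from some
--     position on (an until-witness can always be moved into a bounded window
--     by shifting it down one period), hence on every lasso u v^ω.  Then, for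
--     each positive α, the features separating α from the negatives form a
--     conjunction; the tree testing the disjunction of these conjunctions
--     ("DNF tree") sends positives to true and negatives to false.
--
-- (2) Every correct tree t yields a consistent ψ_t.  A word classified true by t
--     satisfies all literals of some true root-to-leaf path, hence ψ_t; a word
--     classified false violates a literal on every true path, hence not ψ_t.
--     This half needs no decidability beyond that of the formula true.

open import Defs
open import Data.Nat using (ℕ; suc; zero; _+_; _∸_; _≤_; _<_; z≤n; s≤s; nonZero)
open import Data.Nat.Properties
open import Data.Nat.DivMod using ([m+n]%n≡m%n)
open import Data.Nat.Induction using (<-rec)
open import Data.Vec using (Vec; lookup)
open import Data.Product using (_×_; ∃; _,_; proj₁; proj₂)
open import Data.Sum using (_⊎_; inj₁; inj₂)
open import Data.Sum.Function.Propositional using (_⊎-⇔_)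
open import Data.Empty using (⊥; ⊥-elim)
open import Data.Bool using (Bool; true; false)
open import Data.Fin using (Fin)
import Data.Fin as Fin
open import Data.Fin.Subset using (_∈_)
open import Data.Fin.Subset.Properties using (_∈?_)
open import Data.List using (List; []; _∷_; map; foldr; length)
open import Data.List.NonEmpty using (_∷_)
import Data.List.NonEmpty as List⁺
open import Data.List.Relation.Unary.Any using (Any; here; there)
import Data.List.Relation.Unary.Any as Any
import Data.List.Relation.Unary.Any.Properties as Anyₚ
open import Data.List.Relation.Unary.All using (All; []; _∷_)
import Data.List.Relation.Unary.All as All
import Data.List.Relation.Unary.All.Properties as Allₚ
open import Data.List.Membership.Propositional using (mapWith∈) renaming (_∈_ to _∈ˡ_)
open import Function using (_∘_)
open import Function.Bundles using (_⇔_; mk⇔; Equivalence)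
open import Relation.Nullary using (¬_; Dec; yes; no)
open import Relation.Nullary.Decidable using (_⊎-dec_; _×-dec_; ¬?)
open import Relation.Binary.PropositionalEquality using (_≡_; refl; sym; subst)

open Equivalence using (to; from)

Periodic : ∀ {k} → Word k → ℕ → ℕ → Set
Periodic w n p = ∀ j → n ≤ j → w (j + p) ≡ w j

UntilWitness : ∀ {k} → Word k → LTL k → LTL k → ℕ → ℕ → Set
UntilWitness w φ ψ i j = (i ≤ j) × Sat w j ψ × (∀ l → i ≤ l → l < j → Sat w l φ)

module PeriodicSemantics {k} (w : Word k) {n p : ℕ} (periodic : Periodic w n p) where

  Invariant : (ℕ → Set) → Set
  Invariant P = ∀ {l} → n ≤ l → P l ⇔ P (l + p)

  shift-up : ∀ {P} → Invariant P → ∀ {l} → p ≤ l → n ≤ l ∸ p → P (l ∸ p) → P l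
  shift-up {P} inv p≤l n≤l∸p x = subst P (m∸n+n≡m p≤l) (to (inv n≤l∸p) x)

  shift-down : ∀ {P} → Invariant P → ∀ {l} → p ≤ l → n ≤ l ∸ p → P l → P (l ∸ p)
  shift-down {P} inv p≤l n≤l∸p x = from (inv n≤l∸p) (subst P (sym (m∸n+n≡m p≤l)) x)

  -- Until inherits invariance from its arguments: shift the witness by one period.
  until-invariant : ∀ {φ ψ} → Invariant (λ l → Sat w l φ) → Invariant (λ l → Sat w l ψ) →
                    Invariant (λ l → Sat w l (φ U' ψ))
  until-invariant {φ} {ψ} invφ invψ {i} n≤i = mk⇔ later earlier
    where
    later : Sat w i (φ U' ψ) → Sat w (i + p) (φ U' ψ)
    later (j , i≤j , ψj , φ-before) =
      j + p , +-monoˡ-≤ p i≤j , to (invψ (≤-trans n≤i i≤j)) ψj , φ-before'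
      where
      φ-before' : ∀ l → i + p ≤ l → l < j + p → Sat w l φ
      φ-before' l i+p≤l l<j+p =
        shift-up invφ p≤l (≤-trans n≤i i≤l∸p) (φ-before (l ∸ p) i≤l∸p l∸p<j)
        where
        p≤l = m+n≤o⇒n≤o i i+p≤l
        i≤l∸p = m+n≤o⇒m≤o∸n i i+p≤l
        l∸p<j : l ∸ p < j
        l∸p<j = subst (l ∸ p <_) (m+n∸n≡m j p) (∸-monoˡ-< l<j+p p≤l)
    earlier : Sat w (i + p) (φ U' ψ) → Sat w i (φ U' ψ)
    earlier (j , i+p≤j , ψj , φ-before) =
      j ∸ p , i≤j∸p , shift-down invψ p≤j (≤-trans n≤i i≤j∸p) ψj , φ-before'
      where
      p≤j = m+n≤o⇒n≤o i i+p≤j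
      i≤j∸p = m+n≤o⇒m≤o∸n i i+p≤j
      φ-before' : ∀ l → i ≤ l → l < j ∸ p → Sat w l φ
      φ-before' l i≤l l<j∸p = from (invφ (≤-trans n≤i i≤l))
        (φ-before (l + p) (+-monoˡ-≤ p i≤l)
          (subst (l + p <_) (m∸n+n≡m p≤j) (+-monoˡ-< p l<j∸p)))

  shift : ∀ φ → Invariant (λ l → Sat w l φ)
  shift (atom q) n≤l = mk⇔ (subst (q ∈_) (sym (periodic _ n≤l))) (subst (q ∈_) (periodic _ n≤l))
  shift (¬' φ) n≤l = mk⇔ (λ ¬φ φl+p → ¬φ (from (shift φ n≤l) φl+p))
                         (λ ¬φ φl → ¬φ (to (shift φ n≤l) φl))
  shift (φ ∨' ψ) n≤l = shift φ n≤l ⊎-⇔ shift ψ n≤l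
  shift (X' φ) n≤l = shift φ (m≤n⇒m≤1+n n≤l)
  shift (φ U' ψ) = until-invariant {φ} {ψ} (shift φ) (shift ψ)

  UntilWithin : LTL k → LTL k → ℕ → ℕ → Set
  UntilWithin φ ψ zero    i = ⊥
  UntilWithin φ ψ (suc d) i = Sat w i ψ ⊎ (Sat w i φ × UntilWithin φ ψ d (suc i))

  within? : ∀ {φ ψ} → (∀ i → Dec (Sat w i φ)) → (∀ i → Dec (Sat w i ψ)) →
            ∀ d i → Dec (UntilWithin φ ψ d i)
  within? φ? ψ? zero    i = no λ ()
  within? φ? ψ? (suc d) i = ψ? i ⊎-dec (φ? i ×-dec within? φ? ψ? d (suc i))

  within⇒until : ∀ {φ ψ} d i → UntilWithin φ ψ d i → Sat w i (φ U' ψ)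
  within⇒until (suc d) i (inj₁ ψi) = i , ≤-refl , ψi , λ l i≤l l<i → ⊥-elim (<⇒≱ l<i i≤l)
  within⇒until {φ} (suc d) i (inj₂ (φi , rest)) with within⇒until d (suc i) rest
  ... | j , i<j , ψj , φ-before = j , <⇒≤ i<j , ψj , φ-from-i
    where
    φ-from-i : ∀ l → i ≤ l → l < j → Sat w l φ
    φ-from-i l i≤l l<j with m≤n⇒m<n∨m≡n i≤l
    ... | inj₁ i<l = φ-before l i<l l<j
    ... | inj₂ refl = φi

  until⇒within : ∀ {φ ψ} d i {j} → j < i + d → UntilWitness w φ ψ i j → UntilWithin φ ψ d i
  until⇒within zero i {j} j<i+0 (i≤j , _) = <⇒≱ (subst (j <_) (+-identityʳ i) j<i+0) i≤j
  until⇒within {φ} {ψ} (suc d) i {j} j<i+d (i≤j , ψj , φ-before) with m≤n⇒m<n∨m≡n i≤j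
  ... | inj₂ refl = inj₁ ψj
  ... | inj₁ i<j  = inj₂ (φ-before i ≤-refl i<j ,
                          until⇒within {φ} {ψ} d (suc i) (subst (j <_) (+-suc i d) j<i+d)
                            (i<j , ψj , λ l i<l → φ-before l (<⇒≤ i<l)))

  module _ (0<p : 0 < p) where

    witness-down : ∀ {φ ψ i j} → i + (n + p) ≤ j → UntilWitness w φ ψ i j →
                   j ∸ p < j × UntilWitness w φ ψ i (j ∸ p)
    witness-down {φ} {ψ} {i} {j} far (_ , ψj , φ-before) =
      j∸p<j , ≤-trans (m≤m+n i n) i+n≤j∸p , shift-down (shift ψ) p≤j n≤j∸p ψj ,
      λ l i≤l l<j∸p → φ-before l i≤l (<-trans l<j∸p j∸p<j)
      where
      far' : (i + n) + p ≤ j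
      far' = subst (_≤ j) (sym (+-assoc i n p)) far
      p≤j = m+n≤o⇒n≤o (i + n) far'
      i+n≤j∸p = m+n≤o⇒m≤o∸n (i + n) far'
      n≤j∸p = ≤-trans (m≤n+m n i) i+n≤j∸p
      j∸p<j : j ∸ p < j
      j∸p<j = ∸-monoʳ-< {o = 0} 0<p p≤j

    small-witness : ∀ {φ ψ i} j → UntilWitness w φ ψ i j →
                    ∃ λ j' → j' < i + (n + p) × UntilWitness w φ ψ i j'
    small-witness {φ} {ψ} {i} = <-rec Goal step
      where
      Goal : ℕ → Set
      Goal j = UntilWitness w φ ψ i j → ∃ λ j' → j' < i + (n + p) × UntilWitness w φ ψ i j'
      step : ∀ j → (∀ {j'} → j' < j → Goal j') → Goal j
      step j smaller witness with j <? i + (n + p)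
      ... | yes near = j , near , witness
      ... | no  far  with witness-down {φ} {ψ} {i} (≮⇒≥ far) witness
      ...   | j∸p<j , witness' = smaller j∸p<j witness'

    sat? : ∀ φ i → Dec (Sat w i φ)
    sat? (atom q) i = q ∈? w i
    sat? (¬' φ)   i = ¬? (sat? φ i)
    sat? (φ ∨' ψ) i = sat? φ i ⊎-dec sat? ψ i
    sat? (X' φ)   i = sat? φ (suc i)
    sat? (φ U' ψ) i with within? (sat? φ) (sat? ψ) (n + p) i
    ... | yes within = yes (within⇒until (n + p) i within)
    ... | no ¬within = no λ (j , witness) →
      let (j' , near , witness') = small-witness {φ} {ψ} {i} j witness
      in ¬within (until⇒within {φ} {ψ} (n + p) i near witness')

lasso-periodic : ∀ {k} (α : Lasso k) → Periodic (word α) (length (Lasso.u α)) (List⁺.length (Lasso.v α))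
lasso-periodic (u · (x ∷ xs) ^ω) j |u|≤j with j + suc (length xs) <? length u | j <? length u
... | yes j+p<|u| | _ = ⊥-elim (<⇒≱ j+p<|u| (≤-trans |u|≤j (m≤m+n j _)))
... | no _ | yes j<|u| = ⊥-elim (<⇒≱ j<|u| |u|≤j)
... | no _ | no _ rewrite +-∸-comm {j} (suc (length xs)) |u|≤j
                        | [m+n]%n≡m%n (j ∸ length u) (suc (length xs)) {{nonZero}} = refl

lasso-sat? : ∀ {k} (α : Lasso k) φ → Dec (word α ⊨ φ)
lasso-sat? α@(u · (x ∷ xs) ^ω) φ = PeriodicSemantics.sat? (word α) (lasso-periodic α) (s≤s z≤n) φ 0

module DNFTree {k m} (Π : Vec (LTL k) m) where

  Feature : Word k → Fin m → Set
  Feature w i = w ⊨ lookup Π i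

  conjTree : List (Fin m) → DTree m → DTree m
  conjTree is F = foldr (λ i t → node i t F) (leaf true) is

  dnfTree : List (List (Fin m)) → DTree m
  dnfTree = foldr conjTree (leaf false)

  module _ {w : Word k} (feature? : ∀ i → Dec (Feature w i)) where

    conjTree-accept : ∀ {is} F → All (Feature w) is → Classify Π w (conjTree is F) true
    conjTree-accept F []         = leafC
    conjTree-accept F (wi ∷ wis) = yesC wi (conjTree-accept F wis)

    conjTree-pass : ∀ is {F b} → Classify Π w F b → Any (¬_ ∘ Feature w) is →
                    Classify Π w (conjTree is F) b
    conjTree-pass (i ∷ is) cF (here ¬wi) = noC ¬wi cF
    conjTree-pass (i ∷ is) cF (there rest) with feature? i
    ... | yes wi  = yesC wi (conjTree-pass is cF rest)
    ... | no  ¬wi = noC ¬wi cF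

    conjTree-keep-true : ∀ is {F} → Classify Π w F true → Classify Π w (conjTree is F) true
    conjTree-keep-true []       cF = leafC
    conjTree-keep-true (i ∷ is) cF with feature? i
    ... | yes wi  = yesC wi (conjTree-keep-true is cF)
    ... | no  ¬wi = noC ¬wi cF

    dnfTree-true : ∀ {iss} → Any (All (Feature w)) iss → Classify Π w (dnfTree iss) true
    dnfTree-true (here  wis)        = conjTree-accept _ wis
    dnfTree-true {is ∷ _} (there rest) = conjTree-keep-true is (dnfTree-true rest)

    dnfTree-false : ∀ {iss} → All (Any (¬_ ∘ Feature w)) iss → Classify Π w (dnfTree iss) false
    dnfTree-false []                    = leafC
    dnfTree-false {is ∷ _} (fail ∷ rest) = conjTree-pass is (dnfTree-false rest) fail

all-mapWith∈ : ∀ {A B : Set} {P : B → Set} (xs : List A) (f : ∀ {x} → x ∈ˡ xs → B) →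
               (∀ {x} (x∈xs : x ∈ˡ xs) → P (f x∈xs)) → All P (mapWith∈ xs f)
all-mapWith∈ []       f Pf = []
all-mapWith∈ (x ∷ xs) f Pf = Pf (here refl) ∷ all-mapWith∈ xs (f ∘ there) (Pf ∘ there)

module SeparatorTree {k m} (S : Sample k) (Π : Vec (LTL k) m) (separates : Separates Π S) where
  open DNFTree Π

  separators : ∀ {α} → α ∈ˡ Pos S → List (Fin m)
  separators α∈P = mapWith∈ (Neg S) (λ β∈N → proj₁ (separates α∈P β∈N))

  tree : DTree m
  tree = dnfTree (mapWith∈ (Pos S) separators)

  tree-correct : CorrectTree Π S tree
  tree-correct = positive , negative
    where
    positive : ∀ {α} → α ∈ˡ Pos S → Classify Π (word α) tree true
    positive {α} α∈P = dnfTree-true (lasso-sat? α ∘ lookup Π)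
      (Anyₚ.mapWith∈⁺ separators (α , α∈P ,
        all-mapWith∈ (Neg S) _ (λ β∈N → proj₁ (proj₂ (separates α∈P β∈N)))))
    negative : ∀ {β} → β ∈ˡ Neg S → Classify Π (word β) tree false
    negative {β} β∈N = dnfTree-false (lasso-sat? β ∘ lookup Π)
      (all-mapWith∈ (Pos S) separators
        (λ α∈P → Anyₚ.mapWith∈⁺ _ (β , β∈N , proj₂ (proj₂ (separates α∈P β∈N)))))

module BigConnectives {k} {w : Word (suc k)} where

  trueF-valid : w ⊨ trueF
  trueF-valid with Fin.zero ∈? w 0
  ... | yes p = inj₁ p
  ... | no ¬p = inj₂ ¬p

  ⋀-intro : ∀ {L} → All (w ⊨_) L → w ⊨ ⋀ L
  ⋀-intro []       = trueF-valid
  ⋀-intro (φ ∷ φs) (inj₁ ¬φ)  = ¬φ φ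
  ⋀-intro (φ ∷ φs) (inj₂ ¬φs) = ¬φs (⋀-intro φs)

  ⋀-refute : ∀ {L} → Any (¬_ ∘ (w ⊨_)) L → ¬ w ⊨ ⋀ L
  ⋀-refute (here ¬φ)   φ∧φs = φ∧φs (inj₁ ¬φ)
  ⋀-refute (there ¬φs) φ∧φs = φ∧φs (inj₂ (⋀-refute ¬φs))

  ⋁-intro : ∀ {L} → Any (w ⊨_) L → w ⊨ ⋁ L
  ⋁-intro (here φ)   = inj₁ φ
  ⋁-intro (there φs) = inj₂ (⋁-intro φs)

  ⋁-elim : ∀ L → w ⊨ ⋁ L → Any (w ⊨_) L
  ⋁-elim []      ¬true     = ⊥-elim (¬true trueF-valid)
  ⋁-elim (φ ∷ L) (inj₁ φw) = here φw
  ⋁-elim (φ ∷ L) (inj₂ Lw) = there (⋁-elim L Lw)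

module PathSemantics {k m} (Π : Vec (LTL (suc k)) m) {w : Word (suc k)} where
  open BigConnectives {w = w}

  Holds : Fin m × Bool → Set
  Holds ℓ = w ⊨ literal Π ℓ

  paths-true : ∀ {t} → Classify Π w t true → Any (All Holds) (truePaths t)
  paths-true leafC = here []
  paths-true (yesC wi c) = Anyₚ.++⁺ˡ (Anyₚ.map⁺ (Any.map (wi ∷_) (paths-true c)))
  paths-true {node i t f} (noC ¬wi c) =
    Anyₚ.++⁺ʳ (map ((i , true) ∷_) (truePaths t)) (Anyₚ.map⁺ (Any.map (¬wi ∷_) (paths-true c)))

  paths-false : ∀ {t} → Classify Π w t false → All (Any (¬_ ∘ Holds)) (truePaths t)
  paths-false leafC = []
  paths-false {node i t f} (yesC wi c) =
    Allₚ.++⁺ (Allₚ.map⁺ (All.map there (paths-false c)))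
             (Allₚ.map⁺ (All.universal (λ _ → here (λ ¬wi → ¬wi wi)) (truePaths f)))
  paths-false {node i t f} (noC ¬wi c) =
    Allₚ.++⁺ (Allₚ.map⁺ (All.universal (λ _ → here ¬wi) (truePaths t)))
             (Allₚ.map⁺ (All.map there (paths-false c)))

  ψ-true : ∀ {t} → Classify Π w t true → w ⊨ ψ Π t
  ψ-true c = ⋁-intro (Anyₚ.map⁺ (Any.map (⋀-intro ∘ Allₚ.map⁺) (paths-true c)))

  ψ-false : ∀ {t} → Classify Π w t false → ¬ w ⊨ ψ Π t
  ψ-false {t} c ψw = All.lookupWith (λ violated holds → ⋀-refute (Anyₚ.map⁺ violated) holds)
    (paths-false c) (Anyₚ.map⁻ (⋁-elim _ ψw))

theorem2 : ∀ {k m} (S : Sample (suc k)) (Π : Vec (LTL (suc k)) m) →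
    Separates Π S →
    (∃ λ t → CorrectTree Π S t) ×
    (∀ t → CorrectTree Π S t → Consistent (ψ Π t) S)
theorem2 S Π separates =
  (tree , tree-correct) ,
  λ t (positive , negative) → ψ-true ∘ positive , λ β∈N → ψ-false (negative β∈N)
  where
  open SeparatorTree S Π separates
  open PathSemantics Π
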